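{- Let $n\geq r\geq 3$ and let $H$ be a linear $r$-graph with $n$ vertices. Let $u,w\in V(H)$ be adjacent vertices. Then: (i) $e^0_v(N_{uw})=0$ for every $v\in N_1(u,w)$ and every $v\in l_{uw}\setminus\{u,w\}$, and $e^r_v(N_{uw})=0$ for every $v\in N_2(u,w)$; (ii) \[ \sum_{v\in N_u(H)}d_v=\sum_{v\in N_1(u,w)}\sum_{i=1}^{r}e^i_v(N_{uw})+\sum_{v\in N_2(u,w)}\sum_{i=0}^{r-1}e^i_v(N_{uw})+\sum_{v\in l_{uw}\setminus\{u,w\}}\sum_{i=1}^{r}e^i_v(N_{uw})+d_w. \]
   Context: An $r$-graph $H$ has edges that are $r$-element subsets of $V(H)$; it is linear if any two distinct edges share at most one vertex. The degree $d_v$ of $v$ is the number of edges containing $v$. Two vertices are adjacent if some edge contains both; $N_x(H)$ is the set of vertices adjacent to $x$, and $N_{uw}=N_u(H)\cap N_w(H)$. For adjacent $u,w$, $l_{uw}$ is the unique edge containing both. $N_1(u,w)=\{v: v\in N_{uw},\ v\notin l_{uw}\}$ and $N_2(u,w)=N_u(H)\setminus(N_w(H)\cup\{w\})$. For $U\subseteq V(H)$ and a vertex $v$, $E^k_v(U)=\{e\in E(H): v\in e,\ |e\cap U|=k\}$ and $e^k_v(U)=|E^k_v(U)|$. -}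

module Defs where

open import Data.Nat using (ℕ; zero; suc; _≤_; _≟_)
open import Data.Fin using (Fin)
import Data.Fin.Properties as FinP
open import Data.Fin.Subset using (Subset; _∈_; _∉_; _∩_; ∣_∣)
open import Data.Fin.Subset.Properties using (_∈?_)
open import Data.List using (List; filter; length; map; allFin; upTo)
open import Data.Nat.ListAction using (sum)
import Data.List.Membership.Propositional as LM
open import Data.List.Relation.Unary.Unique.Propositional using (Unique)
open import Data.List.Relation.Unary.Any using (any?)
open import Data.Vec using (tabulate)
open import Data.Product using (_×_; Σ; _,_)
open import Data.Bool using (Bool; _∧_; not)
open import Relation.Nullary using (¬_; Dec; does; yes; no)
open import Relation.Nullary.Decidable using (_×-dec_; ¬?)
open import Relation.Binary.PropositionalEquality using (_≡_; _≢_)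

record LinearHypergraph (n r : ℕ) : Set where
  field
    edges   : List (Subset n)
    unique  : Unique edges
    uniform : ∀ {e} → e LM.∈ edges → ∣ e ∣ ≡ r
    linear  : ∀ {e f} → e LM.∈ edges → f LM.∈ edges → e ≢ f → ∣ e ∩ f ∣ ≤ 1
open LinearHypergraph public

module _ {n r : ℕ} (H : LinearHypergraph n r) where

  deg : Fin n → ℕ
  deg v = length (filter (λ e → v ∈? e) (edges H))

  adjacent? : (x y : Fin n) → Bool
  adjacent? x y = does (¬? (x FinP.≟ y))
    ∧ does (any? (λ e → (x ∈? e) ×-dec (y ∈? e)) (edges H))

  Nbhd : Fin n → Subset n
  Nbhd x = tabulate (λ y → adjacent? x y)

  Ncommon : Fin n → Fin n → Subset n
  Ncommon u w = Nbhd u ∩ Nbhd w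

  -- N_1(u,w) = { v ∈ N_{uw} : v ∉ l_{uw} }, with l the edge through u and w
  N1 : Fin n → Fin n → Subset n → Subset n
  N1 u w l = tabulate (λ v → does (v ∈? Ncommon u w) ∧ not (does (v ∈? l)))

  N2 : Fin n → Fin n → Subset n
  N2 u w = tabulate (λ v → does (v ∈? Nbhd u) ∧ not (does (v ∈? Nbhd w)) ∧ not (does (v FinP.≟ w)))

  eCount : ℕ → Fin n → Subset n → ℕ
  eCount k v U = length (filter (λ e → (v ∈? e) ×-dec (∣ e ∩ U ∣ ≟ k)) (edges H))

sumOver : ∀ {n} → Subset n → (Fin n → ℕ) → ℕ
sumOver {n} S f = sum (map f (filter (λ v → v ∈? S) (allFin n)))

-- Σ_{i=a}^{a+m-1} g i
sumRange : ℕ → ℕ → (ℕ → ℕ) → ℕ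
sumRange a m g = sum (map (λ i → g (a Data.Nat.+ i)) (upTo m))

lMinus : ∀ {n} → Subset n → Fin n → Fin n → Subset n
lMinus l u w = tabulate (λ v → does (v ∈? l) ∧ not (does (v FinP.≟ u)) ∧ not (does (v FinP.≟ w)))

-- Every edge through v meets U = N_{uw} in between 0 and r vertices, so d_v = Σ_{i=0}^{r} e^i_v(U).
-- If v ∈ U no edge through v misses U, and if v ∉ U no edge through v lies inside U; so the
-- i = 0 resp. i = r term vanishes. N_u is the disjoint union of N_1(u,w) ⊆ U, N_2(u,w) (disjoint
-- from U), l_{uw} \ {u,w} ⊆ U and {w}; summing the appropriate expression for d_v over each part
-- gives (ii).
module Submission where

open import Defs
open import Algebra.Properties.CommutativeSemigroup using (interchange)
open import Data.Bool using (Bool; true; false; _∧_; not; if_then_else_)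
open import Data.Fin using (Fin; zero; suc)
open import Data.Fin.Properties using (_≟_)
open import Data.Fin.Subset using (Subset; _∈_; _∉_; _∩_; ∣_∣)
open import Data.Fin.Subset.Properties
  using (_∈?_; p∩q⊆p; p∩q⊆q; x∈p∩q⁺; x∈p∩q⁻; ∣p∩q∣≤∣p∣; p⊂q⇒∣p∣<∣q∣; x∈p⇒∣p-x∣<∣p∣)
open import Data.List using (List; []; _∷_; [_]; _++_; filter; length; map; upTo; allFin)
import Data.List.Membership.Propositional as LM
open import Data.List.Properties
  using (map-cong; map-++; map-applyUpTo; map-upTo; upTo-∷ʳ; map-tabulate; filter-none)
open import Data.List.Relation.Unary.All as All using ()
open import Data.List.Relation.Unary.Any as Any using (here; there; any?)
import Data.Nat as ℕ
open import Data.Nat using (ℕ; zero; suc; _≤_; _<_; _+_; s≤s)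
open import Data.Nat.ListAction using (sum)
open import Data.Nat.ListAction.Properties using (sum-++)
open import Data.Nat.Properties
  using (+-identityʳ; +-commutativeSemigroup; ≤-trans; ≤-reflexive; <⇒≢; m<n⇒n≢0)
open import Data.Product using (_×_; _,_; proj₁; proj₂)
import Data.Vec as Vec
open import Data.Vec.Properties using (lookup∘tabulate; lookup-zipWith)
open import Relation.Nullary using (does; yes; no; _×-dec_)
open import Relation.Nullary.Decidable using (dec-true; dec-false)
open import Level using (0ℓ)
open import Relation.Unary using (Pred; Decidable)
open import Relation.Binary.PropositionalEquality
  using (_≡_; _≢_; refl; sym; trans; cong; cong₂; module ≡-Reasoning)

mask : Bool → ℕ → ℕ
mask b x = if b then x else 0

module _ {A : Set} where

  sum-map-zero : (xs : List A) → sum (map (λ _ → 0) xs) ≡ 0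
  sum-map-zero []       = refl
  sum-map-zero (x ∷ xs) = sum-map-zero xs

  sum-map-+ : ∀ (f g : A → ℕ) xs → sum (map (λ x → f x + g x) xs) ≡ sum (map f xs) + sum (map g xs)
  sum-map-+ f g []       = refl
  sum-map-+ f g (x ∷ xs) =
    trans (cong (f x + g x +_) (sum-map-+ f g xs)) (interchange +-commutativeSemigroup (f x) (g x) _ _)

  sum-map-cong : ∀ {f g : A → ℕ} xs → (∀ x → f x ≡ g x) → sum (map f xs) ≡ sum (map g xs)
  sum-map-cong xs f≗g = cong sum (map-cong f≗g xs)

  sum-map-filter : ∀ {P : Pred A 0ℓ} (P? : Decidable P) (f : A → ℕ) xs →
                   sum (map f (filter P? xs)) ≡ sum (map (λ x → mask (does (P? x)) (f x)) xs)
  sum-map-filter P? f []       = refl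
  sum-map-filter P? f (x ∷ xs) with does (P? x)
  ... | true  = cong (f x +_) (sum-map-filter P? f xs)
  ... | false = sum-map-filter P? f xs

sumRange-suc : ∀ g m → sumRange 0 (suc m) g ≡ g 0 + sumRange 1 m g
sumRange-suc g m =
  cong (λ xs → g 0 + sum xs) (trans (map-applyUpTo suc g m) (sym (map-upTo (λ i → g (suc i)) m)))

sumRange-sucʳ : ∀ g m → sumRange 0 (suc m) g ≡ sumRange 0 m g + g m
sumRange-sucʳ g m = begin
  sum (map g (upTo (suc m)))        ≡⟨ cong (λ xs → sum (map g xs)) (sym (upTo-∷ʳ m)) ⟩
  sum (map g (upTo m ++ [ m ]))     ≡⟨ cong sum (map-++ g (upTo m) [ m ]) ⟩
  sum (map g (upTo m) ++ [ g m ])   ≡⟨ sum-++ (map g (upTo m)) [ g m ] ⟩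
  sum (map g (upTo m)) + (g m + 0)  ≡⟨ cong (sum (map g (upTo m)) +_) (+-identityʳ (g m)) ⟩
  sum (map g (upTo m)) + g m        ∎
  where open ≡-Reasoning

sumRange-indicator : ∀ {k m} → k < m → sumRange 0 m (λ i → mask (does (k ℕ.≟ i)) 1) ≡ 1
sumRange-indicator {zero}  {suc m} _         =
  trans (sumRange-suc (λ i → mask (does (0 ℕ.≟ i)) 1) m) (cong suc (sum-map-zero (upTo m)))
sumRange-indicator {suc k} {suc m} (s≤s k<m) =
  trans (sumRange-suc (λ i → mask (does (suc k ℕ.≟ i)) 1) m) (sumRange-indicator k<m)

mask-as-sumRange : ∀ b {k m} → k < m → mask b 1 ≡ sumRange 0 m (λ i → mask (b ∧ does (k ℕ.≟ i)) 1)
mask-as-sumRange true  k<m = sym (sumRange-indicator k<m)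
mask-as-sumRange false {m = m} _ = sym (sum-map-zero (upTo m))

map-allFin-suc : ∀ {B : Set} n (f : Fin (suc n) → B) →
                 map f (allFin (suc n)) ≡ f zero ∷ map (λ v → f (suc v)) (allFin n)
map-allFin-suc n f =
  cong (f zero ∷_) (trans (map-tabulate suc f) (sym (map-tabulate (λ v → v) (λ v → f (suc v)))))

sum-allFin-indicator : ∀ n (w : Fin n) d → sum (map (λ v → mask (does (v ≟ w)) d) (allFin n)) ≡ d
sum-allFin-indicator (suc n) zero d = begin
  sum (map (λ v → mask (does (v ≟ zero)) d) (allFin (suc n)))
    ≡⟨ cong sum (map-allFin-suc n _) ⟩
  d + sum (map (λ _ → 0) (allFin n))
    ≡⟨ cong (d +_) (sum-map-zero (allFin n)) ⟩
  d + 0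
    ≡⟨ +-identityʳ d ⟩
  d ∎
  where open ≡-Reasoning
sum-allFin-indicator (suc n) (suc w) d =
  trans (cong sum (map-allFin-suc n (λ v → mask (does (v ≟ suc w)) d))) (sum-allFin-indicator n w d)

length-filter-∷ : ∀ {A : Set} {P : Pred A 0ℓ} (P? : Decidable P) x xs →
                  length (filter P? (x ∷ xs)) ≡ mask (does (P? x)) 1 + length (filter P? xs)
length-filter-∷ P? x xs with does (P? x)
... | true  = refl
... | false = refl

length-filter-by-key : ∀ {A : Set} {P : Pred A 0ℓ} (P? : Decidable P) (key : A → ℕ) m xs →
  (∀ {x} → x LM.∈ xs → key x < m) →
  length (filter P? xs) ≡ sumRange 0 m (λ i → length (filter (λ x → P? x ×-dec (key x ℕ.≟ i)) xs))
length-filter-by-key P? key m []       _       = sym (sum-map-zero (upTo m))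
length-filter-by-key {P = P} P? key m (x ∷ xs) key<m = begin
  length (filter P? (x ∷ xs))
    ≡⟨ length-filter-∷ P? x xs ⟩
  mask (does (P? x)) 1 + length (filter P? xs)
    ≡⟨ cong₂ _+_ (mask-as-sumRange (does (P? x)) (key<m (here refl)))
                 (length-filter-by-key P? key m xs (λ x∈xs → key<m (there x∈xs))) ⟩
  sumRange 0 m (λ i → mask (does (Q? i x)) 1) + sumRange 0 m (λ i → length (filter (Q? i) xs))
    ≡⟨ sym (sum-map-+ _ _ (upTo m)) ⟩
  sumRange 0 m (λ i → mask (does (Q? i x)) 1 + length (filter (Q? i) xs))
    ≡⟨ sum-map-cong (upTo m) (λ i → sym (length-filter-∷ (Q? i) x xs)) ⟩
  sumRange 0 m (λ i → length (filter (Q? i) (x ∷ xs))) ∎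
  where
    open ≡-Reasoning
    Q? : ∀ i → Decidable (λ y → P y × key y ≡ i)
    Q? i y = P? y ×-dec (key y ℕ.≟ i)

does-∈? : ∀ {n} (v : Fin n) (p : Subset n) → does (v ∈? p) ≡ Vec.lookup p v
does-∈? zero    (true  Vec.∷ p) = refl
does-∈? zero    (false Vec.∷ p) = refl
does-∈? (suc v) (_     Vec.∷ p) = does-∈? v p

does-∈?-tabulate : ∀ {n} (f : Fin n → Bool) v → does (v ∈? Vec.tabulate f) ≡ f v
does-∈?-tabulate f v = trans (does-∈? v (Vec.tabulate f)) (lookup∘tabulate f v)

does-∈?-∩ : ∀ {n} (p q : Subset n) v → does (v ∈? p ∩ q) ≡ does (v ∈? p) ∧ does (v ∈? q)
does-∈?-∩ p q v = trans (does-∈? v (p ∩ q))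
  (trans (lookup-zipWith _∧_ v p q) (sym (cong₂ _∧_ (does-∈? v p) (does-∈? v q))))

module _ {n} {f : Fin n → Bool} {v : Fin n} where

  ∈-tabulate⁻ : v ∈ Vec.tabulate f → f v ≡ true
  ∈-tabulate⁻ v∈ = trans (sym (does-∈?-tabulate f v)) (dec-true (v ∈? Vec.tabulate f) v∈)

  ∈-tabulate⁺ : f v ≡ true → v ∈ Vec.tabulate f
  ∈-tabulate⁺ fv≡true with v ∈? Vec.tabulate f | does-∈?-tabulate f v
  ... | yes v∈ | _ = v∈
  ... | no _   | false≡fv with () ← trans false≡fv fv≡true

x∈p⇒∣p∣≢0 : ∀ {n} {p : Subset n} {x} → x ∈ p → ∣ p ∣ ≢ 0
x∈p⇒∣p∣≢0 x∈p = m<n⇒n≢0 (x∈p⇒∣p-x∣<∣p∣ x∈p)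

x∈p∖q⇒∣p∩q∣<∣p∣ : ∀ {n} {p q : Subset n} {x} → x ∈ p → x ∉ q → ∣ p ∩ q ∣ < ∣ p ∣
x∈p∖q⇒∣p∩q∣<∣p∣ {p = p} {q} {x} x∈p x∉q =
  p⊂q⇒∣p∣<∣q∣ (p∩q⊆p p q , x , x∈p , λ x∈p∩q → x∉q (p∩q⊆q p q x∈p∩q))

module _ {n r : ℕ} (H : LinearHypergraph n r) where

  eCount-0-of-member : ∀ {v U} → v ∈ U → eCount H 0 v U ≡ 0
  eCount-0-of-member {v} {U} v∈U =
    cong length (filter-none (λ e → (v ∈? e) ×-dec (∣ e ∩ U ∣ ℕ.≟ 0)) {edges H} (All.tabulate
      λ _ (v∈e , ∣e∩U∣≡0) → x∈p⇒∣p∣≢0 (x∈p∩q⁺ (v∈e , v∈U)) ∣e∩U∣≡0))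

  eCount-r-of-nonmember : ∀ {v U} → v ∉ U → eCount H r v U ≡ 0
  eCount-r-of-nonmember {v} {U} v∉U =
    cong length (filter-none (λ e → (v ∈? e) ×-dec (∣ e ∩ U ∣ ℕ.≟ r)) {edges H} (All.tabulate
      λ e∈H (v∈e , ∣e∩U∣≡r) →
        <⇒≢ (x∈p∖q⇒∣p∩q∣<∣p∣ v∈e v∉U) (trans ∣e∩U∣≡r (sym (uniform H e∈H)))))

  deg-by-intersection : ∀ v U → deg H v ≡ sumRange 0 (suc r) (λ i → eCount H i v U)
  deg-by-intersection v U = length-filter-by-key (v ∈?_) (λ e → ∣ e ∩ U ∣) (suc r) (edges H)
    (λ {e} e∈H → s≤s (≤-trans (∣p∩q∣≤∣p∣ e U) (≤-reflexive (uniform H e∈H))))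

  deg-of-member : ∀ {v U} → v ∈ U → deg H v ≡ sumRange 1 r (λ i → eCount H i v U)
  deg-of-member {v} {U} v∈U = begin
    deg H v                           ≡⟨ deg-by-intersection v U ⟩
    sumRange 0 (suc r) (e v U)        ≡⟨ sumRange-suc (e v U) r ⟩
    e v U 0 + sumRange 1 r (e v U)    ≡⟨ cong (_+ sumRange 1 r (e v U)) (eCount-0-of-member v∈U) ⟩
    sumRange 1 r (e v U)              ∎
    where
      open ≡-Reasoning
      e : Fin n → Subset n → ℕ → ℕ
      e v U i = eCount H i v U

  deg-of-nonmember : ∀ {v U} → v ∉ U → deg H v ≡ sumRange 0 r (λ i → eCount H i v U)
  deg-of-nonmember {v} {U} v∉U = begin
    deg H v                           ≡⟨ deg-by-intersection v U ⟩
    sumRange 0 (suc r) (e v U)        ≡⟨ sumRange-sucʳ (e v U) r ⟩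
    sumRange 0 r (e v U) + e v U r    ≡⟨ cong (sumRange 0 r (e v U) +_) (eCount-r-of-nonmember v∉U) ⟩
    sumRange 0 r (e v U) + 0          ≡⟨ +-identityʳ _ ⟩
    sumRange 0 r (e v U)              ∎
    where
      open ≡-Reasoning
      e : Fin n → Subset n → ℕ → ℕ
      e v U i = eCount H i v U

  Nbhd-irrefl : ∀ {x} → x ∉ Nbhd H x
  Nbhd-irrefl {x} x∈Nx with x ≟ x | ∈-tabulate⁻ x∈Nx
  ... | no x≢x | _  = x≢x refl
  ... | yes _  | ()

  edge⇒∈Nbhd : ∀ {e x y} → e LM.∈ edges H → x ∈ e → y ∈ e → x ≢ y → y ∈ Nbhd H x
  edge⇒∈Nbhd {e} {x} {y} e∈H x∈e y∈e x≢y = ∈-tabulate⁺ adjacent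
    where
      adjacent : adjacent? H x y ≡ true
      adjacent rewrite dec-false (x ≟ y) x≢y
                     | dec-true (any? (λ f → (x ∈? f) ×-dec (y ∈? f)) (edges H))
                                (Any.map (λ { refl → x∈e , y∈e }) e∈H) = refl

module _ {n r : ℕ} (H : LinearHypergraph n r) (u w : Fin n) (l : Subset n) where

  does-∈?-Ncommon : ∀ v → does (v ∈? Ncommon H u w) ≡ does (v ∈? Nbhd H u) ∧ does (v ∈? Nbhd H w)
  does-∈?-Ncommon = does-∈?-∩ (Nbhd H u) (Nbhd H w)

  does-∈?-N1 : ∀ v → does (v ∈? N1 H u w l) ≡ does (v ∈? Ncommon H u w) ∧ not (does (v ∈? l))
  does-∈?-N1 = does-∈?-tabulate _

  does-∈?-N2 : ∀ v → does (v ∈? N2 H u w)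
               ≡ does (v ∈? Nbhd H u) ∧ not (does (v ∈? Nbhd H w)) ∧ not (does (v ≟ w))
  does-∈?-N2 = does-∈?-tabulate _

  does-∈?-lMinus : ∀ v → does (v ∈? lMinus l u w)
                   ≡ does (v ∈? l) ∧ not (does (v ≟ u)) ∧ not (does (v ≟ w))
  does-∈?-lMinus = does-∈?-tabulate _

  N1⊆Ncommon : ∀ {v} → v ∈ N1 H u w l → v ∈ Ncommon H u w
  N1⊆Ncommon {v} v∈N1 with v ∈? Ncommon H u w | ∈-tabulate⁻ v∈N1
  ... | yes v∈U | _ = v∈U
  ... | no _    | ()

  ∈N2⇒∉Ncommon : ∀ {v} → v ∈ N2 H u w → v ∉ Ncommon H u w
  ∈N2⇒∉Ncommon {v} v∈N2 v∈U with v ∈? Nbhd H u | v ∈? Nbhd H w | ∈-tabulate⁻ v∈N2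
  ... | _     | no v∉Nw | _  = v∉Nw (proj₂ (x∈p∩q⁻ (Nbhd H u) (Nbhd H w) v∈U))
  ... | no _  | yes _   | ()
  ... | yes _ | yes _   | ()

  module _ (u≢w : u ≢ w) (l∈H : l LM.∈ edges H) (u∈l : u ∈ l) (w∈l : w ∈ l) where

    ∈l⇒∈Ncommon : ∀ {v} → v ∈ l → v ≢ u → v ≢ w → v ∈ Ncommon H u w
    ∈l⇒∈Ncommon v∈l v≢u v≢w = x∈p∩q⁺ (edge⇒∈Nbhd H l∈H u∈l v∈l (λ u≡v → v≢u (sym u≡v)) ,
                                        edge⇒∈Nbhd H l∈H w∈l v∈l (λ w≡v → v≢w (sym w≡v)))

    lMinus⊆Ncommon : ∀ {v} → v ∈ lMinus l u w → v ∈ Ncommon H u w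
    lMinus⊆Ncommon {v} v∈l∖uw with v ∈? l | v ≟ u | v ≟ w | ∈-tabulate⁻ v∈l∖uw
    ... | yes v∈l | no v≢u | no v≢w | _ = ∈l⇒∈Ncommon v∈l v≢u v≢w
    ... | no _  | _     | _     | ()
    ... | yes _ | yes _ | _     | ()
    ... | yes _ | no _  | yes _ | ()

    deg⁺ deg⁻ : Fin n → ℕ
    deg⁺ v = sumRange 1 r (λ i → eCount H i v (Ncommon H u w))
    deg⁻ v = sumRange 0 r (λ i → eCount H i v (Ncommon H u w))

    degree-partition : ∀ v →
      mask (does (v ∈? Nbhd H u)) (deg H v)
        ≡ mask (does (v ∈? N1 H u w l)) (deg⁺ v) + mask (does (v ∈? N2 H u w)) (deg⁻ v)
          + mask (does (v ∈? lMinus l u w)) (deg⁺ v) + mask (does (v ≟ w)) (deg H w)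
    degree-partition v
      rewrite does-∈?-N1 v | does-∈?-N2 v | does-∈?-lMinus v | does-∈?-Ncommon v
      with v ≟ w
    ... | yes refl
      rewrite dec-true (w ∈? Nbhd H u) (edge⇒∈Nbhd H l∈H u∈l w∈l u≢w)
            | dec-false (w ∈? Nbhd H w) (Nbhd-irrefl H)
            | dec-true (w ∈? l) w∈l
            | dec-false (w ≟ u) (λ w≡u → u≢w (sym w≡u)) = refl
    ... | no v≢w with v ≟ u
    ...   | yes refl rewrite dec-false (u ∈? Nbhd H u) (Nbhd-irrefl H) | dec-true (u ∈? l) u∈l = refl
    ...   | no v≢u with v ∈? l
    ...     | yes v∈l with ∈l⇒∈Ncommon v∈l v≢u v≢w
    ...       | v∈U rewrite dec-true (v ∈? Nbhd H u) (proj₁ (x∈p∩q⁻ (Nbhd H u) (Nbhd H w) v∈U))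
                          | dec-true (v ∈? Nbhd H w) (proj₂ (x∈p∩q⁻ (Nbhd H u) (Nbhd H w) v∈U))
                          = trans (deg-of-member H v∈U) (sym (+-identityʳ _))
    degree-partition v | no v≢w | no v≢u | no v∉l with v ∈? Nbhd H u | v ∈? Nbhd H w
    ... | no _     | _        = refl
    ... | yes v∈Nu | yes v∈Nw =
      trans (deg-of-member H (x∈p∩q⁺ (v∈Nu , v∈Nw)))
            (sym (trans (+-identityʳ _) (trans (+-identityʳ _) (+-identityʳ _))))
    ... | yes v∈Nu | no v∉Nw  =
      trans (deg-of-nonmember H (λ v∈U → v∉Nw (proj₂ (x∈p∩q⁻ (Nbhd H u) (Nbhd H w) v∈U))))
            (sym (trans (+-identityʳ _) (+-identityʳ _)))

    sum-degree-partition :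
      sumOver (Nbhd H u) (deg H)
        ≡ sumOver (N1 H u w l) deg⁺ + sumOver (N2 H u w) deg⁻ + sumOver (lMinus l u w) deg⁺ + deg H w
    sum-degree-partition = begin
      sumOver (Nbhd H u) (deg H)
        ≡⟨ sum-map-filter (_∈? Nbhd H u) (deg H) (allFin n) ⟩
      Σ (λ v → mask (does (v ∈? Nbhd H u)) (deg H v))
        ≡⟨ sum-map-cong (allFin n) degree-partition ⟩
      Σ (λ v → on-N1 v + on-N2 v + on-lMinus v + at-w v)
        ≡⟨ sum-map-+ (λ v → on-N1 v + on-N2 v + on-lMinus v) at-w (allFin n) ⟩
      Σ (λ v → on-N1 v + on-N2 v + on-lMinus v) + Σ at-w
        ≡⟨ cong (_+ Σ at-w) (sum-map-+ (λ v → on-N1 v + on-N2 v) on-lMinus (allFin n)) ⟩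
      Σ (λ v → on-N1 v + on-N2 v) + Σ on-lMinus + Σ at-w
        ≡⟨ cong (λ s → s + Σ on-lMinus + Σ at-w) (sum-map-+ on-N1 on-N2 (allFin n)) ⟩
      Σ on-N1 + Σ on-N2 + Σ on-lMinus + Σ at-w
        ≡⟨ cong (Σ on-N1 + Σ on-N2 + Σ on-lMinus +_) (sum-allFin-indicator n w (deg H w)) ⟩
      Σ on-N1 + Σ on-N2 + Σ on-lMinus + deg H w
        ≡⟨ sym (cong (_+ deg H w) (cong₂ _+_
             (cong₂ _+_ (sum-map-filter (_∈? N1 H u w l) deg⁺ (allFin n))
                        (sum-map-filter (_∈? N2 H u w) deg⁻ (allFin n)))
             (sum-map-filter (_∈? lMinus l u w) deg⁺ (allFin n)))) ⟩
      sumOver (N1 H u w l) deg⁺ + sumOver (N2 H u w) deg⁻ + sumOver (lMinus l u w) deg⁺ + deg H w ∎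
      where
        open ≡-Reasoning
        Σ : (Fin n → ℕ) → ℕ
        Σ f = sum (map f (allFin n))
        on-N1 on-N2 on-lMinus at-w : Fin n → ℕ
        on-N1     v = mask (does (v ∈? N1 H u w l)) (deg⁺ v)
        on-N2     v = mask (does (v ∈? N2 H u w)) (deg⁻ v)
        on-lMinus v = mask (does (v ∈? lMinus l u w)) (deg⁺ v)
        at-w      v = mask (does (v ≟ w)) (deg H w)

lemma3p1 : (n r : ℕ) → 3 ≤ r → r ≤ n → (H : LinearHypergraph n r)
    → (u w : Fin n) → u ≢ w
    → (l : Subset n) → l LM.∈ edges H → u ∈ l → w ∈ l
    → ((∀ v → v ∈ N1 H u w l → eCount H 0 v (Ncommon H u w) ≡ 0)
       × (∀ v → v ∈ lMinus l u w → eCount H 0 v (Ncommon H u w) ≡ 0)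
       × (∀ v → v ∈ N2 H u w → eCount H r v (Ncommon H u w) ≡ 0))
      × (sumOver (Nbhd H u) (deg H)
         ≡ sumOver (N1 H u w l) (λ v → sumRange 1 r (λ i → eCount H i v (Ncommon H u w)))
           + sumOver (N2 H u w) (λ v → sumRange 0 r (λ i → eCount H i v (Ncommon H u w)))
           + sumOver (lMinus l u w) (λ v → sumRange 1 r (λ i → eCount H i v (Ncommon H u w)))
           + deg H w)
lemma3p1 n r _ _ H u w u≢w l l∈H u∈l w∈l =
  ( (λ v v∈N1 → eCount-0-of-member H (N1⊆Ncommon H u w l v∈N1))
  , (λ v v∈l∖uw → eCount-0-of-member H (lMinus⊆Ncommon H u w l u≢w l∈H u∈l w∈l v∈l∖uw))
  , (λ v v∈N2 → eCount-r-of-nonmember H (∈N2⇒∉Ncommon H u w l v∈N2)) )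
  , sum-degree-partition H u w l u≢w l∈H u∈l w∈l
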